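{- For an integer $h\ge 0$, define $t(0)=1$ and $t(k+1)=2^{t(k)}$ for $k\ge 0$, so that $t(h)=2^{(2^{(\cdots^{(2^0)})})}$ with the number $2$ appearing $h+1$ times. Then the number of canonical game trees of height at most $h$ (i.e. the number of equivalence classes, under the equivalence defined below, of finite rooted trees of height at most $h$) is exactly $t(h)$. For instance there are $16$ canonical game trees of height at most $3$.
   Context: All trees are finite rooted trees; the height of a rooted tree is the maximal number of edges on a path from the root to a leaf (a single vertex has height $0$). Equivalence of rooted trees is defined recursively: two rooted trees $A_1$ and $A_2$ are equivalent if the set of equivalence classes of the subtrees rooted at the children of the root of $A_1$ equals the set of equivalence classes of the subtrees rooted at the children of the root of $A_2$ (multiplicities are ignored; in particular any two single-vertex trees are equivalent). A canonical game tree is a tree with a minimal number of vertices in its equivalence class; canonical game trees are counted up to this equivalence (one per class). -}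

module Defs where

open import Data.Nat using (ℕ; zero; suc; _^_; _⊔_)
open import Data.List using (List; []; _∷_)
open import Data.List.Relation.Unary.All using (All)
open import Data.List.Relation.Unary.Any using (Any)

data Tree : Set where
  node : List Tree → Tree

mutual
  height : Tree → ℕ
  height (node []) = 0
  height (node (c ∷ cs)) = suc (heights (c ∷ cs))

  heights : List Tree → ℕ
  heights [] = 0
  heights (c ∷ cs) = height c ⊔ heights cs

-- the recursive equivalence: the set of classes of children of the roots coincide
-- (every child of A is equivalent to some child of B and vice versa; multiplicities ignored)
data _~_ : Tree → Tree → Set where
  node~ : ∀ {as bs} →
          All (λ a → Any (λ b → a ~ b) bs) as →
          All (λ b → Any (λ a → a ~ b) as) bs →
          node as ~ node bs

t : ℕ → ℕ
t zero = 1
t (suc k) = 2 ^ t k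

module Submission where

-- Up to ~, a tree of height ≤ h+1 is nothing but the SET of the
-- classes of its children, and those children have height ≤ h.  So if the
-- classes of height ≤ h are enumerated by Fin (t h), the classes of height
-- ≤ h+1 are enumerated by the subsets of Fin (t h), i.e. by characteristic
-- functions Fin (t h) → Fin 2, and the library bijection
-- finToFun / funToFin between Fin (2 ^ n) and Fin n → Fin 2 enumerates these
-- by Fin (2 ^ t h) = Fin (t (h+1)).

open import Defs
open import Data.Nat using (ℕ; _^_; zero; suc; _≤_; z≤n; s≤s; s≤s⁻¹)
open import Data.Nat.Properties using (⊔-lub; m⊔n≤o⇒m≤o; m⊔n≤o⇒n≤o)
open import Data.Fin using (Fin; zero; suc; funToFin; finToFun; combine; _≟_)
open import Data.Fin.Properties using (finToFun-funToFin; funToFin-finToFin)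
open import Data.List using (List; []; _∷_; map)
open import Data.List.Relation.Unary.All using (All; []; _∷_)
import Data.List.Relation.Unary.All as All
open import Data.List.Relation.Unary.Any using (Any; here; there; any?)
open import Data.List.Membership.Propositional using (_∈_; find; lose)
open import Data.List.Membership.Propositional.Properties using (∈-map⁺; ∈-map⁻)
open import Data.Product using (Σ; _×_; ∃; _,_)
import Data.Product as Product
open import Function using (_∘_; id)
open import Relation.Binary.PropositionalEquality
  using (_≡_; refl; sym; trans; cong₂; subst; _≗_)
open import Relation.Nullary using (yes; no; contradiction)

Subset : ℕ → Set
Subset n = Fin n → Fin 2

_∈ˢ_ : ∀ {n} → Fin n → Subset n → Set
k ∈ˢ χ = χ k ≡ suc zero

subset-ext : ∀ {n} (χ ψ : Subset n) →
  (∀ k → k ∈ˢ χ → k ∈ˢ ψ) → (∀ k → k ∈ˢ ψ → k ∈ˢ χ) → χ ≗ ψ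
subset-ext χ ψ χ⊆ψ ψ⊆χ k = bit-ext (χ k) (ψ k) (χ⊆ψ k) (ψ⊆χ k)
  where
  bit-ext : (a b : Fin 2) → (a ≡ suc zero → b ≡ suc zero) → (b ≡ suc zero → a ≡ suc zero) → a ≡ b
  bit-ext zero       zero       _ _ = refl
  bit-ext (suc zero) (suc zero) _ _ = refl
  bit-ext zero       (suc zero) _ b⇒a with b⇒a refl
  ... | ()
  bit-ext (suc zero) zero       a⇒b _ with a⇒b refl
  ... | ()

indicator : ∀ {n} → List (Fin n) → Subset n
indicator ks k with any? (k ≟_) ks
... | yes _ = suc zero
... | no  _ = zero

indicator⁺ : ∀ {n} {ks : List (Fin n)} {k} → k ∈ ks → k ∈ˢ indicator ks
indicator⁺ {ks = ks} {k} k∈ks with any? (k ≟_) ks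
... | yes _    = refl
... | no  k∉ks = contradiction k∈ks k∉ks

indicator⁻ : ∀ {n} {ks : List (Fin n)} {k} → k ∈ˢ indicator ks → k ∈ ks
indicator⁻ {ks = ks} {k} k∈χ with any? (k ≟_) ks
... | yes k∈ks = k∈ks
indicator⁻ {ks = ks} {k} () | no _

-- Enumerating subsets by Fin (2 ^ n): funToFin only depends on the values of
-- its argument, hence finToFun is injective.
funToFin-cong : ∀ {m n} {f g : Fin m → Fin n} → f ≗ g → funToFin f ≡ funToFin g
funToFin-cong {zero}  f≗g = refl
funToFin-cong {suc m} f≗g = cong₂ combine (f≗g zero) (funToFin-cong (f≗g ∘ suc))

finToFun-injective : ∀ {n} (i j : Fin (2 ^ n)) → finToFun {2} {n} i ≗ finToFun j → i ≡ j
finToFun-injective {n} i j eq = trans (sym (funToFin-finToFin {n} {2} i))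
  (trans (funToFin-cong eq) (funToFin-finToFin {n} {2} j))

members : ∀ {a} {A : Set a} {n} → (Fin n → A) → Subset n → List A
members {n = zero}  r χ = []
members {A = A} {n = suc n} r χ = prependIf (χ zero) (members (r ∘ suc) (χ ∘ suc))
  where
  prependIf : Fin 2 → List A → List A
  prependIf zero       xs = xs
  prependIf (suc zero) xs = r zero ∷ xs

members⁻ : ∀ {a} {A : Set a} {n} (r : Fin n → A) χ {x} →
  x ∈ members r χ → ∃ λ k → k ∈ˢ χ × x ≡ r k
members⁻ {n = suc n} r χ x∈ with χ zero in χ₀
... | zero       = Product.map suc id (members⁻ (r ∘ suc) (χ ∘ suc) x∈)
... | suc zero with x∈
...   | here x≡   = zero , χ₀ , x≡
...   | there x∈′ = Product.map suc id (members⁻ (r ∘ suc) (χ ∘ suc) x∈′)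

members⁺ : ∀ {a} {A : Set a} {n} (r : Fin n → A) χ {k} → k ∈ˢ χ → r k ∈ members r χ
members⁺ {n = suc n} r χ {zero} k∈χ rewrite k∈χ = here refl
members⁺ {n = suc n} r χ {suc k} k∈χ with χ zero
... | zero       = members⁺ (r ∘ suc) (χ ∘ suc) k∈χ
... | suc zero   = there (members⁺ (r ∘ suc) (χ ∘ suc) k∈χ)

members-⊆ : ∀ {a ℓ} {A : Set a} {R : A → A → Set ℓ} {n} (r : Fin n → A) χ ψ →
  (∀ {k k′} → R (r k) (r k′) → k ≡ k′) →
  All (λ x → Any (R x) (members r ψ)) (members r χ) →
  ∀ k → k ∈ˢ χ → k ∈ˢ ψ
members-⊆ r χ ψ reflects covered k k∈χ with find (All.lookup covered (members⁺ r χ k∈χ))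
... | y , y∈ , rk-R-y with members⁻ r ψ y∈
... | k′ , k′∈ψ , refl = subst (_∈ˢ ψ) (sym (reflects rk-R-y)) k′∈ψ

node~members : ∀ {n} (r : Fin n → Tree) (label : Tree → Fin n) χ cs →
  All (λ c → c ~ r (label c)) cs →
  (∀ k → k ∈ map label cs → k ∈ˢ χ) → (∀ k → k ∈ˢ χ → k ∈ map label cs) →
  node cs ~ node (members r χ)
node~members r label χ cs c~r labels⊆χ χ⊆labels =
  node~ (All.tabulate forward) (All.tabulate backward)
  where
  forward : ∀ {c} → c ∈ cs → Any (c ~_) (members r χ)
  forward c∈ = lose (members⁺ r χ (labels⊆χ _ (∈-map⁺ label c∈))) (All.lookup c~r c∈)

  backward : ∀ {b} → b ∈ members r χ → Any (_~ b) cs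
  backward b∈ with members⁻ r χ b∈
  ... | k , k∈χ , refl with ∈-map⁻ label (χ⊆labels k k∈χ)
  ...   | c , c∈ , refl = lose c∈ (All.lookup c~r c∈)

node-height≤ : ∀ {h} cs → All (λ c → height c ≤ h) cs → height (node cs) ≤ suc h
node-height≤ []       _ = z≤n
node-height≤ {h} (c ∷ cs) bounded = s≤s (heights≤ (c ∷ cs) bounded)
  where
  heights≤ : ∀ cs → All (λ c → height c ≤ h) cs → heights cs ≤ h
  heights≤ []       []       = z≤n
  heights≤ (c ∷ cs) (p ∷ ps) = ⊔-lub p (heights≤ cs ps)

node-height≤⁻ : ∀ {h} cs → height (node cs) ≤ suc h → All (λ c → height c ≤ h) cs
node-height≤⁻ []       _ = []
node-height≤⁻ {h} (c ∷ cs) p = children≤ (c ∷ cs) (s≤s⁻¹ p)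
  where
  children≤ : ∀ cs → heights cs ≤ h → All (λ c → height c ≤ h) cs
  children≤ []       _ = []
  children≤ (c ∷ cs) p = m⊔n≤o⇒m≤o (height c) _ p ∷ children≤ cs (m⊔n≤o⇒n≤o (height c) _ p)

rep : (h : ℕ) → Fin (t h) → Tree
rep zero    _ = node []
rep (suc h) i = node (members (rep h) (finToFun i))

index : (h : ℕ) → Tree → Fin (t h)
index zero    _         = zero
index (suc h) (node cs) = funToFin (indicator (map (index h) cs))

rep-height : ∀ h i → height (rep h i) ≤ h
rep-height zero    i = z≤n
rep-height (suc h) i = node-height≤ _ (All.tabulate bounded)
  where
  bounded : ∀ {x} → x ∈ members (rep h) (finToFun i) → height x ≤ h
  bounded x∈ with members⁻ (rep h) (finToFun i) x∈
  ... | k , _ , refl = rep-height h k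

-- Equivalent representatives select the same subset (using injectivity one
-- level down), hence have the same code.
rep-injective : ∀ h (i j : Fin (t h)) → rep h i ~ rep h j → i ≡ j
rep-injective zero    zero zero _ = refl
rep-injective (suc h) i j (node~ i⊑j j⊑i) = finToFun-injective {t h} i j
  (subset-ext χ ψ (members-⊆ (rep h) χ ψ (rep-injective h _ _) i⊑j)
                  (members-⊆ (rep h) ψ χ (sym ∘ rep-injective h _ _) j⊑i))
  where
  χ ψ : Subset (t h)
  χ = finToFun i
  ψ = finToFun j

index-correct : ∀ h T → height T ≤ h → T ~ rep h (index h T)
index-correct zero    (node [])      _ = node~ [] []
index-correct zero    (node (_ ∷ _)) ()
index-correct (suc h) (node cs)      p =
  node~members (rep h) (index h) χ cs children~
    (λ k k∈ → trans (decode k) (indicator⁺ k∈))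
    (λ k k∈χ → indicator⁻ (trans (sym (decode k)) k∈χ))
  where
  labels χ : Subset (t h)
  labels = indicator (map (index h) cs)
  χ = finToFun (funToFin labels)
  decode : χ ≗ labels
  decode = finToFun-funToFin labels
  children~ : All (λ c → c ~ rep h (index h c)) cs
  children~ = All.map (λ {c} c≤h → index-correct h c c≤h) (node-height≤⁻ cs p)

mainTheorem1 : (h : ℕ) →
    Σ (Fin (t h) → Tree) λ rep →
    ((i : Fin (t h)) → height (rep i) ≤ h) ×
    ((i j : Fin (t h)) → rep i ~ rep j → i ≡ j) ×
    ((T : Tree) → height T ≤ h → ∃ λ i → T ~ rep i)
mainTheorem1 h =
  rep h , rep-height h , rep-injective h , λ T T≤h → index h T , index-correct h T T≤h
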